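{- Let $n>1$ and let $d\ge 1$ be an integer. The number of permutations $\pi\in S_n$ with $cd(\pi)=d$ and $d(\pi)=d-1$ equals $d\,A_{n-1,d}$, and the number of permutations $\pi\in S_n$ with $cd(\pi)=d$ and $d(\pi)=d$ equals $(n-d)\,A_{n-1,d}$.
   Context: For $\pi\in S_n$, $d(\pi)$ is the number of $i$ with $1\le i\le n-1$ and $\pi(i)>\pi(i+1)$ (descents). A permutation $\pi$ has a cyclic descent at position $n$ if $\pi(n)>\pi(1)$; the number of cyclic descents $cd(\pi)$ is $d(\pi)+1$ if $\pi$ has a cyclic descent at position $n$, and $d(\pi)$ otherwise. $A_{m,j}$ denotes the Eulerian number: the number of permutations in $S_m$ with exactly $j-1$ descents (equal to $0$ if there are none). -}

module Defs where

open import Data.Nat using (ℕ; zero; suc; _+_; _∸_; _<ᵇ_; _≡ᵇ_)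
open import Data.Bool using (Bool; true; false; _∧_; if_then_else_; not)
open import Data.Fin using (Fin; toℕ) renaming (_≟_ to _≟ᶠ_)
open import Data.Vec using (Vec; []; _∷_; head; last)
open import Data.List using (List; []; _∷_; concatMap; map; length; filterᵇ; allFin)
open import Relation.Nullary.Decidable using (⌊_⌋)

allWords : (n k : ℕ) → List (Vec (Fin n) k)
allWords n zero    = [] ∷ []
allWords n (suc k) = concatMap (λ w → map (λ a → a ∷ w) (allFin n)) (allWords n k)

notIn : ∀ {n k} → Fin n → Vec (Fin n) k → Bool
notIn a []       = true
notIn a (b ∷ w)  = not ⌊ a ≟ᶠ b ⌋ ∧ notIn a w

-- A word of length n over Fin n is a permutation (one-line notation) iff its entries are distinct.
distinct : ∀ {n k} → Vec (Fin n) k → Bool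
distinct []      = true
distinct (a ∷ w) = notIn a w ∧ distinct w

Sym : (n : ℕ) → List (Vec (Fin n) n)
Sym n = filterᵇ distinct (allWords n n)

toN : Bool → ℕ
toN true  = 1
toN false = 0

des : ∀ {n k} → Vec (Fin n) k → ℕ
des []            = 0
des (a ∷ [])      = 0
des (a ∷ b ∷ w)   = toN (toℕ b <ᵇ toℕ a) + des (b ∷ w)

cdes : ∀ {n k} → Vec (Fin n) k → ℕ
cdes []      = 0
cdes (a ∷ w) = des (a ∷ w) + toN (toℕ a <ᵇ toℕ (last (a ∷ w)))

countSym : (n : ℕ) → (Vec (Fin n) n → Bool) → ℕ
countSym n P = length (filterᵇ P (Sym n))

-- Eulerian number A_{m,j}: number of π ∈ S_m with exactly j-1 descents (0 if j = 0)
A : ℕ → ℕ → ℕ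
A m zero    = 0
A m (suc j) = countSym m (λ π → des π ≡ᵇ j)

{-# OPTIONS --safe #-}
-- Rotation π ↦ π(2) … π(n) π(1) preserves cd(π), and exactly cd(π) of the n rotations of π have a cyclic
-- descent at position n, since rotating brings each cyclic descent of π to that position once.
-- Every rotation class contains exactly one permutation n σ beginning with n, and cd(n σ) = d(σ) + 1 for
-- σ ∈ S_{n-1}, so A_{n-1,d} classes have cd = d. Given cd(π) = d, one has d(π) = d - 1 if π has a cyclic
-- descent at position n and d(π) = d otherwise; hence the first count is d A_{n-1,d} and the two counts
-- add up to n A_{n-1,d}.
module Submission where

open import Defs
open import Algebra.Bundles using (CommutativeMonoid)
import Algebra.Properties.CommutativeSemigroup as CommutativeSemigroupProperties
open import Data.Bool using (Bool; true; false; _∧_; not; T)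
open import Data.Bool.Properties using (∧-commutativeMonoid; ∧-conicalˡ; ∧-conicalʳ; ∧-comm; ∧-zeroʳ; ∧-idem)
open import Data.Fin using (Fin; zero; suc; toℕ; fromℕ; inject₁; opposite; punchOut; _≟_)
open import Data.Fin.Properties
  using (toℕ-inject₁; toℕ-fromℕ; toℕ<n; fromℕ≢inject₁; inject₁-injective; opposite-prop;
         any?; punchOut-injective; injective⇒≤)
open import Data.Fin.Permutation using (reverse)
open import Data.List using (List; []; _∷_; _++_; map; concatMap; length; filterᵇ; tabulate; allFin)
open import Data.Nat using (ℕ; zero; suc; _+_; _*_; _∸_; _≤_; _<_; s≤s; _<ᵇ_; _≡ᵇ_)
open import Data.Nat.Properties
  using (+-*-semiring; +-commutativeSemigroup; +-comm; +-assoc; +-identityʳ; *-identityˡ; *-identityʳ; *-zeroʳ; *-comm;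
         *-distribˡ-+; *-distribʳ-+; suc-injective; *-distribʳ-∸; *-assoc; ≡ᵇ⇒≡; m+[n∸m]≡n; m+n∸m≡n; 1+n≰n)
open import Algebra.Properties.Semiring.Sum +-*-semiring
  using (sum; sum-syntax; ∑-comm; ∑-permute; *-distribˡ-sum; *-distribʳ-sum; sum-init-last;
         sum-cong-≗; sum-replicate-zero; ∑-distrib-+)
open import Data.Product using (∃; _×_; _,_)
open import Data.Vec using (Vec; []; _∷_; _∷ʳ_; head; last; lookup) renaming (map to mapᵥ)
open import Data.Vec.Properties using (last-∷ʳ)
open import Function using (_∘_; _⇔_; mk⇔)
open import Function.Definitions using (Injective)
open import Relation.Nullary using (Dec; yes; no; ¬_; contradiction)
open import Relation.Nullary.Decidable using (⌊_⌋; isYes≗does; dec-true; dec-false; does-⇔; ⌊⌋-map′)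
open import Relation.Binary.PropositionalEquality

private
  variable
    X Y : Set
    k m n : ℕ

  module ∧ = CommutativeSemigroupProperties (CommutativeMonoid.commutativeSemigroup ∧-commutativeMonoid)
  module + = CommutativeSemigroupProperties +-commutativeSemigroup

-- Finite sums

sumOver : List X → (X → ℕ) → ℕ
sumOver []       f = 0
sumOver (x ∷ xs) f = f x + sumOver xs f

infixl 10 sumOver
syntax sumOver xs (λ x → e) = ∑[ x ∈ xs ] e

sumOver-cong : ∀ (xs : List X) {f g : X → ℕ} → f ≗ g → sumOver xs f ≡ sumOver xs g
sumOver-cong []       f≗g = refl
sumOver-cong (x ∷ xs) f≗g = cong₂ _+_ (f≗g x) (sumOver-cong xs f≗g)

sumOver-++ : ∀ (xs ys : List X) f → sumOver (xs ++ ys) f ≡ sumOver xs f + sumOver ys f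
sumOver-++ []       ys f = refl
sumOver-++ (x ∷ xs) ys f = trans (cong (f x +_) (sumOver-++ xs ys f)) (sym (+-assoc (f x) _ _))

sumOver-map : ∀ (xs : List X) (h : X → Y) f → sumOver (map h xs) f ≡ sumOver xs (f ∘ h)
sumOver-map []       h f = refl
sumOver-map (x ∷ xs) h f = cong (f (h x) +_) (sumOver-map xs h f)

sumOver-concatMap : ∀ (xs : List X) (g : X → List Y) f →
  sumOver (concatMap g xs) f ≡ ∑[ x ∈ xs ] sumOver (g x) f
sumOver-concatMap []       g f = refl
sumOver-concatMap (x ∷ xs) g f =
  trans (sumOver-++ (g x) (concatMap g xs) f) (cong (sumOver (g x) f +_) (sumOver-concatMap xs g f))

sumOver-+ : ∀ (xs : List X) f g → ∑[ x ∈ xs ] (f x + g x) ≡ sumOver xs f + sumOver xs g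
sumOver-+ []       f g = refl
sumOver-+ (x ∷ xs) f g = trans (cong (f x + g x +_) (sumOver-+ xs f g)) (+.interchange (f x) (g x) _ _)

sumOver-*ʳ : ∀ (xs : List X) f c → ∑[ x ∈ xs ] (f x * c) ≡ sumOver xs f * c
sumOver-*ʳ []       f c = refl
sumOver-*ʳ (x ∷ xs) f c = trans (cong (f x * c +_) (sumOver-*ʳ xs f c)) (sym (*-distribʳ-+ c (f x) _))

sumOver-∑-comm : ∀ (xs : List X) (f : X → Fin n → ℕ) →
  ∑[ x ∈ xs ] ∑[ i < n ] f x i ≡ ∑[ i < n ] ∑[ x ∈ xs ] f x i
sumOver-∑-comm {n = n} []       f = sym (sum-replicate-zero n)
sumOver-∑-comm         (x ∷ xs) f =
  trans (cong (sum (f x) +_) (sumOver-∑-comm xs f)) (sym (∑-distrib-+ (f x) _))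

sumOver-tabulate : ∀ (h : Fin n → X) f → sumOver (tabulate h) f ≡ ∑[ i < n ] f (h i)
sumOver-tabulate {n = zero}  h f = refl
sumOver-tabulate {n = suc n} h f = cong (f (h zero) +_) (sumOver-tabulate (h ∘ suc) f)

length≡sumOver-filterᵇ : ∀ (P : X → Bool) xs → length (filterᵇ P xs) ≡ ∑[ x ∈ xs ] toN (P x)
length≡sumOver-filterᵇ P []       = refl
length≡sumOver-filterᵇ P (x ∷ xs) with P x
... | true  = cong suc (length≡sumOver-filterᵇ P xs)
... | false = length≡sumOver-filterᵇ P xs

sumOver-filterᵇ : ∀ (P : X → Bool) f xs → sumOver (filterᵇ P xs) f ≡ ∑[ x ∈ xs ] (toN (P x) * f x)
sumOver-filterᵇ P f []       = refl
sumOver-filterᵇ P f (x ∷ xs) with P x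
... | true  = cong₂ _+_ (sym (+-identityʳ (f x))) (sumOver-filterᵇ P f xs)
... | false = sumOver-filterᵇ P f xs

⌊⌋-yes : (x? : Dec X) → X → ⌊ x? ⌋ ≡ true
⌊⌋-yes x? x = trans (isYes≗does x?) (dec-true x? x)

⌊⌋-no : (x? : Dec X) → ¬ X → ⌊ x? ⌋ ≡ false
⌊⌋-no x? ¬x = trans (isYes≗does x?) (dec-false x? ¬x)

⌊⌋-⇔ : X ⇔ Y → (x? : Dec X) (y? : Dec Y) → ⌊ x? ⌋ ≡ ⌊ y? ⌋
⌊⌋-⇔ X⇔Y x? y? = trans (isYes≗does x?) (trans (does-⇔ X⇔Y x? y?) (sym (isYes≗does y?)))

≡ᵇ-suc-exclusive : ∀ x y → (x ≡ᵇ suc y) ∧ (x ≡ᵇ y) ≡ false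
≡ᵇ-suc-exclusive zero    y       = refl
≡ᵇ-suc-exclusive (suc x) zero    = ∧-zeroʳ (x ≡ᵇ 0)
≡ᵇ-suc-exclusive (suc x) (suc y) = ≡ᵇ-suc-exclusive x y

toN-∧-idem : ∀ b → toN (b ∧ b) ≡ toN b * 1
toN-∧-idem b = trans (cong toN (∧-idem b)) (sym (*-identityʳ (toN b)))

≡ᵇ-indicator-cong : ∀ x y {f g} → (x ≡ y → f ≡ g) → toN (x ≡ᵇ y) * f ≡ toN (x ≡ᵇ y) * g
≡ᵇ-indicator-cong x y f≡g with x ≡ᵇ y in eq
... | true  = cong (1 *_) (f≡g (≡ᵇ⇒≡ x y (subst T (sym eq) _)))
... | false = refl

indicator-absorbs : ∀ b {s} y → (b ≡ true → s ≡ 1) → toN b * y ≡ s * (toN b * y)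
indicator-absorbs false {s} y _   = sym (*-zeroʳ s)
indicator-absorbs true      y s≡1 =
  trans (sym (*-identityˡ (toN true * y))) (cong (_* (toN true * y)) (sym (s≡1 refl)))

∑-const : ∀ n c → ∑[ i < n ] c ≡ n * c
∑-const zero    c = refl
∑-const (suc n) c = cong (c +_) (∑-const n c)

∑-select : ∀ (t : Fin n) (h : Fin n → ℕ) → ∑[ a < n ] (toN ⌊ a ≟ t ⌋ * h a) ≡ h t
∑-select {suc n} zero    h =
  trans (cong₂ _+_ (*-identityˡ (h zero)) (sum-replicate-zero n)) (+-identityʳ (h zero))
∑-select {suc n} (suc t) h =
  trans (sum-cong-≗ (λ a → cong (λ b → toN b * h (suc a)) (⌊⌋-map′ (cong suc) _ (a ≟ t))))
        (∑-select t (h ∘ suc))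

∑-reverse : ∀ (f : Fin n → ℕ) → ∑[ i < n ] f (opposite i) ≡ ∑[ i < n ] f i
∑-reverse f = sym (∑-permute f reverse)

∑-avoiding-fromℕ : ∀ b (g : Fin (suc m) → ℕ) →
  ∑[ a < suc m ] (toN (not ⌊ fromℕ m ≟ a ⌋ ∧ b) * g a) ≡ toN b * ∑[ a < m ] g (inject₁ a)
∑-avoiding-fromℕ {m} b g = begin
  ∑[ a < suc m ] (toN (not ⌊ fromℕ m ≟ a ⌋ ∧ b) * g a)
    ≡⟨ sum-init-last (λ a → toN (not ⌊ fromℕ m ≟ a ⌋ ∧ b) * g a) ⟩
  ∑[ a < m ] (toN (not ⌊ fromℕ m ≟ inject₁ a ⌋ ∧ b) * g (inject₁ a))
    + toN (not ⌊ fromℕ m ≟ fromℕ m ⌋ ∧ b) * g (fromℕ m)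
    ≡⟨ cong₂ _+_
         (sum-cong-≗ {m} λ a → cong (λ x → toN (not x ∧ b) * g (inject₁ a))
                                    (⌊⌋-no (fromℕ m ≟ inject₁ a) fromℕ≢inject₁))
         (cong (λ x → toN (not x ∧ b) * g (fromℕ m)) (⌊⌋-yes (fromℕ m ≟ fromℕ m) refl)) ⟩
  ∑[ a < m ] (toN b * g (inject₁ a)) + 0
    ≡⟨ +-identityʳ _ ⟩
  ∑[ a < m ] (toN b * g (inject₁ a))
    ≡⟨ *-distribˡ-sum {m} (toN b) (g ∘ inject₁) ⟨
  toN b * ∑[ a < m ] g (inject₁ a)
    ∎
  where open ≡-Reasoning

injective⇒surjective : ∀ {f : Fin n → Fin n} → Injective _≡_ _≡_ f → ∀ t → ∃ λ i → f i ≡ t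
injective⇒surjective {suc n} {f} f-injective t with any? (λ i → f i ≟ t)
... | yes found  = found
... | no ¬found = contradiction (injective⇒≤ punchOut∘f-injective) 1+n≰n
  where
  t≢f : ∀ i → t ≢ f i
  t≢f i t≡fi = ¬found (i , sym t≡fi)
  punchOut∘f-injective : Injective _≡_ _≡_ (λ i → punchOut (t≢f i))
  punchOut∘f-injective eq = f-injective (punchOut-injective (t≢f _) (t≢f _) eq)

injective⇒∑-fibre≡1 : ∀ {f : Fin n → Fin n} → Injective _≡_ _≡_ f → ∀ t →
  ∑[ j < n ] toN ⌊ f j ≟ t ⌋ ≡ 1
injective⇒∑-fibre≡1 {n} {f} f-injective t with injective⇒surjective f-injective t
... | i , fi≡t = begin
  ∑[ j < n ] toN ⌊ f j ≟ t ⌋       ≡⟨ sum-cong-≗ (λ j → cong toN (⌊⌋-⇔ (fibre j) (f j ≟ t) (j ≟ i))) ⟩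
  ∑[ j < n ] toN ⌊ j ≟ i ⌋         ≡⟨ sum-cong-≗ (λ j → sym (*-identityʳ (toN ⌊ j ≟ i ⌋))) ⟩
  ∑[ j < n ] (toN ⌊ j ≟ i ⌋ * 1)   ≡⟨ ∑-select i (λ _ → 1) ⟩
  1                                ∎
  where
  open ≡-Reasoning
  fibre : ∀ j → f j ≡ t ⇔ j ≡ i
  fibre j = mk⇔ (λ fj≡t → f-injective (trans fj≡t (sym fi≡t))) (λ { refl → fi≡t })

-- Rotations

rotate : Vec X (suc k) → Vec X (suc k)
rotate (a ∷ w) = w ∷ʳ a

rotate^ : ℕ → Vec X (suc k) → Vec X (suc k)
rotate^ zero    v = v
rotate^ (suc j) v = rotate^ j (rotate v)

rotate^-+ : ∀ i j (v : Vec X (suc k)) → rotate^ (i + j) v ≡ rotate^ j (rotate^ i v)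
rotate^-+ zero    j v = refl
rotate^-+ (suc i) j v = rotate^-+ i j (rotate v)

rotate^-suc : ∀ j (v : Vec X (suc k)) → rotate^ (suc j) v ≡ rotate (rotate^ j v)
rotate^-suc j v = trans (cong (λ i → rotate^ i v) (+-comm 1 j)) (rotate^-+ j 1 v)

lookup-∷ʳ-inject₁ : ∀ (w : Vec X k) a i → lookup (w ∷ʳ a) (inject₁ i) ≡ lookup w i
lookup-∷ʳ-inject₁ (b ∷ w) a zero    = refl
lookup-∷ʳ-inject₁ (b ∷ w) a (suc i) = lookup-∷ʳ-inject₁ w a i

lookup-fromℕ : ∀ (v : Vec X (suc k)) → lookup v (fromℕ k) ≡ last v
lookup-fromℕ (a ∷ [])    = refl
lookup-fromℕ (a ∷ b ∷ w) = lookup-fromℕ (b ∷ w)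

last-rotate : ∀ (v : Vec X (suc k)) → last (rotate v) ≡ head v
last-rotate (a ∷ w) = last-∷ʳ a w

-- Recursion on i rather than on j, whose recursive call is at inject₁ j, makes the induction structural.
head-rotate^ : ∀ (v : Vec X (suc k)) j {i} → toℕ j ≡ i → head (rotate^ i v) ≡ lookup v j
head-rotate^ (a ∷ w) zero    {zero}  _  = refl
head-rotate^ (a ∷ w) (suc j) {suc i} eq =
  trans (head-rotate^ (w ∷ʳ a) (inject₁ j) (trans (toℕ-inject₁ j) (suc-injective eq)))
        (lookup-∷ʳ-inject₁ w a j)

last-rotate^-suc : ∀ (v : Vec X (suc k)) j {i} → toℕ j ≡ i → last (rotate^ (suc i) v) ≡ lookup v j
last-rotate^-suc v j {i} eq = begin
  last (rotate^ (suc i) v)    ≡⟨ cong last (rotate^-suc i v) ⟩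
  last (rotate (rotate^ i v)) ≡⟨ last-rotate (rotate^ i v) ⟩
  head (rotate^ i v)          ≡⟨ head-rotate^ v j eq ⟩
  lookup v j                  ∎
  where open ≡-Reasoning

head-rotate^-length : ∀ (v : Vec X (suc k)) → head (rotate^ (suc k) v) ≡ head v
head-rotate^-length {k = k} v = begin
  head (rotate^ k (rotate v))  ≡⟨ head-rotate^ (rotate v) (fromℕ k) (toℕ-fromℕ k) ⟩
  lookup (rotate v) (fromℕ k)  ≡⟨ lookup-fromℕ (rotate v) ⟩
  last (rotate v)              ≡⟨ last-rotate v ⟩
  head v                       ∎
  where open ≡-Reasoning

last-rotate^-length : ∀ (v : Vec X (suc k)) → last (rotate^ (suc k) v) ≡ last v
last-rotate^-length {k = k} v = trans (last-rotate^-suc v (fromℕ k) (toℕ-fromℕ k)) (lookup-fromℕ v)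

head-rotate^-opposite : ∀ (v : Vec X (suc k)) j →
  head (rotate^ (toℕ (opposite j)) (rotate^ (suc (toℕ j)) v)) ≡ head v
head-rotate^-opposite {k = k} v j = begin
  head (rotate^ (toℕ (opposite j)) (rotate^ (suc (toℕ j)) v))  ≡⟨ cong head (rotate^-+ (suc (toℕ j)) _ v) ⟨
  head (rotate^ (suc (toℕ j) + toℕ (opposite j)) v)           ≡⟨ cong (λ i → head (rotate^ i v)) j+opposite-j ⟩
  head (rotate^ (suc k) v)                                     ≡⟨ head-rotate^-length v ⟩
  head v                                                       ∎
  where
  open ≡-Reasoning
  j+opposite-j : suc (toℕ j) + toℕ (opposite j) ≡ suc k
  j+opposite-j = trans (cong (suc (toℕ j) +_) (opposite-prop j)) (m+[n∸m]≡n (toℕ<n j))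

orbitSum : (Vec X (suc k) → ℕ) → Vec X (suc k) → ℕ
orbitSum {k = k} F v = ∑[ j < suc k ] F (rotate^ (suc (toℕ j)) v)

sumOver-allWords-∷ : ∀ n k (f : Vec (Fin n) (suc k) → ℕ) →
  ∑[ w ∈ allWords n (suc k) ] f w ≡ ∑[ w ∈ allWords n k ] ∑[ a < n ] f (a ∷ w)
sumOver-allWords-∷ n k f = trans (sumOver-concatMap (allWords n k) _ f)
  (sumOver-cong (allWords n k) λ w →
    trans (sumOver-map (allFin n) (_∷ w) f) (sumOver-tabulate (λ a → a) (λ a → f (a ∷ w))))

sumOver-allWords-∷ʳ : ∀ n k (f : Vec (Fin n) (suc k) → ℕ) →
  ∑[ w ∈ allWords n (suc k) ] f w ≡ ∑[ w ∈ allWords n k ] ∑[ a < n ] f (w ∷ʳ a)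
sumOver-allWords-∷ʳ n zero    f = sumOver-allWords-∷ n zero f
sumOver-allWords-∷ʳ n (suc k) f = begin
  ∑[ w ∈ allWords n (suc (suc k)) ] f w
    ≡⟨ sumOver-allWords-∷ n (suc k) f ⟩
  ∑[ w ∈ allWords n (suc k) ] ∑[ a < n ] f (a ∷ w)
    ≡⟨ sumOver-allWords-∷ʳ n k (λ w → ∑[ a < n ] f (a ∷ w)) ⟩
  ∑[ w ∈ allWords n k ] ∑[ b < n ] ∑[ a < n ] f (a ∷ (w ∷ʳ b))
    ≡⟨ sumOver-cong (allWords n k) (λ w → ∑-comm (λ b a → f (a ∷ (w ∷ʳ b)))) ⟩
  ∑[ w ∈ allWords n k ] ∑[ a < n ] ∑[ b < n ] f ((a ∷ w) ∷ʳ b)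
    ≡⟨ sumOver-allWords-∷ n k (λ w → ∑[ b < n ] f (w ∷ʳ b)) ⟨
  ∑[ w ∈ allWords n (suc k) ] ∑[ b < n ] f (w ∷ʳ b)
    ∎
  where open ≡-Reasoning

sumOver-allWords-rotate^ : ∀ n k j (f : Vec (Fin n) (suc k) → ℕ) →
  ∑[ w ∈ allWords n (suc k) ] f (rotate^ j w) ≡ ∑[ w ∈ allWords n (suc k) ] f w
sumOver-allWords-rotate^ n k zero    f = refl
sumOver-allWords-rotate^ n k (suc j) f =
  trans (sumOver-allWords-∷ n k (λ w → f (rotate^ j (rotate w))))
    (trans (sym (sumOver-allWords-∷ʳ n k (f ∘ rotate^ j))) (sumOver-allWords-rotate^ n k j f))

sumOver-allWords-avoiding-fromℕ : ∀ m k (h : Vec (Fin (suc m)) k → ℕ) →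
  ∑[ σ ∈ allWords (suc m) k ] (toN (notIn (fromℕ m) σ) * h σ) ≡ ∑[ σ ∈ allWords m k ] h (mapᵥ inject₁ σ)
sumOver-allWords-avoiding-fromℕ m zero    h = +-identityʳ (h [] + 0)
sumOver-allWords-avoiding-fromℕ m (suc k) h = begin
  ∑[ σ ∈ allWords (suc m) (suc k) ] (toN (notIn (fromℕ m) σ) * h σ)
    ≡⟨ sumOver-allWords-∷ (suc m) k _ ⟩
  ∑[ w ∈ allWords (suc m) k ] ∑[ a < suc m ] (toN (not ⌊ fromℕ m ≟ a ⌋ ∧ notIn (fromℕ m) w) * h (a ∷ w))
    ≡⟨ sumOver-cong (allWords (suc m) k) (λ w → ∑-avoiding-fromℕ (notIn (fromℕ m) w) (λ a → h (a ∷ w))) ⟩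
  ∑[ w ∈ allWords (suc m) k ] (toN (notIn (fromℕ m) w) * ∑[ a < m ] h (inject₁ a ∷ w))
    ≡⟨ sumOver-allWords-avoiding-fromℕ m k (λ w → ∑[ a < m ] h (inject₁ a ∷ w)) ⟩
  ∑[ σ ∈ allWords m k ] ∑[ a < m ] h (inject₁ a ∷ mapᵥ inject₁ σ)
    ≡⟨ sumOver-allWords-∷ m k (h ∘ mapᵥ inject₁) ⟨
  ∑[ σ ∈ allWords m (suc k) ] h (mapᵥ inject₁ σ)
    ∎
  where open ≡-Reasoning

-- Descents under rotation

isDescent : Fin n → Fin n → ℕ
isDescent a b = toN (toℕ b <ᵇ toℕ a)

endDescent : Vec (Fin n) (suc k) → ℕ
endDescent v = isDescent (last v) (head v)

cdes≡des+endDescent : ∀ (v : Vec (Fin n) (suc k)) → cdes v ≡ des v + endDescent v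
cdes≡des+endDescent (a ∷ w) = refl

des-lookup : ∀ (v : Vec (Fin n) (suc k)) →
  des v ≡ ∑[ i < k ] isDescent (lookup v (inject₁ i)) (lookup v (suc i))
des-lookup (a ∷ [])    = refl
des-lookup (a ∷ b ∷ w) = cong (isDescent a b +_) (des-lookup (b ∷ w))

des-∷ʳ : ∀ a b (w : Vec (Fin n) k) → des ((b ∷ w) ∷ʳ a) ≡ des (b ∷ w) + isDescent (last (b ∷ w)) a
des-∷ʳ a b []      = +-identityʳ (isDescent b a)
des-∷ʳ a b (c ∷ w) = trans (cong (isDescent b c +_) (des-∷ʳ a c w)) (sym (+-assoc (isDescent b c) _ _))

cdes-rotate : ∀ (v : Vec (Fin n) (suc k)) → cdes (rotate v) ≡ cdes v
cdes-rotate (a ∷ [])    = refl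
cdes-rotate (a ∷ b ∷ w) = begin
  des ((b ∷ w) ∷ʳ a) + isDescent (last ((b ∷ w) ∷ʳ a)) b
    ≡⟨ cong₂ _+_ (des-∷ʳ a b w) (cong (λ x → isDescent x b) (last-∷ʳ a (b ∷ w))) ⟩
  des (b ∷ w) + isDescent (last (b ∷ w)) a + isDescent a b
    ≡⟨ +.xy∙z≈zx∙y (des (b ∷ w)) (isDescent (last (b ∷ w)) a) (isDescent a b) ⟩
  isDescent a b + des (b ∷ w) + isDescent (last (b ∷ w)) a
    ∎
  where open ≡-Reasoning

cdes-rotate^ : ∀ j (v : Vec (Fin n) (suc k)) → cdes (rotate^ j v) ≡ cdes v
cdes-rotate^ zero    v = refl
cdes-rotate^ (suc j) v = trans (cdes-rotate^ j (rotate v)) (cdes-rotate v)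

orbitSum-endDescent : ∀ (v : Vec (Fin n) (suc k)) → orbitSum endDescent v ≡ cdes v
orbitSum-endDescent {k = k} v = begin
  ∑[ j < suc k ] e j                                                    ≡⟨ sum-init-last e ⟩
  ∑[ i < k ] e (inject₁ i) + e (fromℕ k)                                ≡⟨ cong₂ _+_ (sum-cong-≗ e-inject₁) e-fromℕ ⟩
  ∑[ i < k ] isDescent (lookup v (inject₁ i)) (lookup v (suc i)) + endDescent v
                                                                        ≡⟨ cong (_+ endDescent v) (des-lookup v) ⟨
  des v + endDescent v                                                  ≡⟨ cdes≡des+endDescent v ⟨
  cdes v                                                                ∎
  where
  open ≡-Reasoning
  e : Fin (suc k) → ℕ
  e j = endDescent (rotate^ (suc (toℕ j)) v)
  e-inject₁ : ∀ i → e (inject₁ i) ≡ isDescent (lookup v (inject₁ i)) (lookup v (suc i))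
  e-inject₁ i = cong₂ isDescent (last-rotate^-suc v (inject₁ i) refl)
                                (head-rotate^ v (suc i) (cong suc (sym (toℕ-inject₁ i))))
  e-fromℕ : e (fromℕ k) ≡ endDescent v
  e-fromℕ = trans (cong (λ i → endDescent (rotate^ (suc i) v)) (toℕ-fromℕ k))
                  (cong₂ isDescent (last-rotate^-length v) (head-rotate^-length v))

orbitSum-cdes-* : ∀ (g : ℕ → ℕ) F (v : Vec (Fin n) (suc k)) →
  orbitSum (λ u → g (cdes u) * F u) v ≡ g (cdes v) * orbitSum F v
orbitSum-cdes-* {k = k} g F v = trans
  (sum-cong-≗ {suc k} (λ j → cong (λ c → g c * F (rotate^ (suc (toℕ j)) v)) (cdes-rotate^ (suc (toℕ j)) v)))
  (sym (*-distribˡ-sum {suc k} (g (cdes v)) (λ j → F (rotate^ (suc (toℕ j)) v))))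

isDescent-fromℕˡ : ∀ (b : Fin (suc m)) → b ≢ fromℕ m → isDescent (fromℕ m) b ≡ 1
isDescent-fromℕˡ {zero}  zero    b≢top = contradiction refl b≢top
isDescent-fromℕˡ {suc m} zero    _     = refl
isDescent-fromℕˡ {suc m} (suc b) b≢top = isDescent-fromℕˡ b (b≢top ∘ cong suc)

isDescent-fromℕʳ : ∀ (a : Fin (suc m)) → isDescent a (fromℕ m) ≡ 0
isDescent-fromℕʳ         zero    = refl
isDescent-fromℕʳ {suc m} (suc a) = isDescent-fromℕʳ a

des-inject₁ : ∀ (w : Vec (Fin m) k) → des (mapᵥ inject₁ w) ≡ des w
des-inject₁ []          = refl
des-inject₁ (a ∷ [])    = refl
des-inject₁ (a ∷ b ∷ w) = cong₂ _+_
  (cong₂ (λ x y → toN (y <ᵇ x)) (toℕ-inject₁ a) (toℕ-inject₁ b)) (des-inject₁ (b ∷ w))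

notIn-∷ʳ : ∀ b a (w : Vec (Fin n) k) → notIn b (w ∷ʳ a) ≡ not ⌊ b ≟ a ⌋ ∧ notIn b w
notIn-∷ʳ b a []      = refl
notIn-∷ʳ b a (c ∷ w) = trans (cong (not ⌊ b ≟ c ⌋ ∧_) (notIn-∷ʳ b a w)) (∧.x∙yz≈y∙xz (not ⌊ b ≟ c ⌋) (not ⌊ b ≟ a ⌋) (notIn b w))

distinct-∷ʳ : ∀ a (w : Vec (Fin n) k) → distinct (w ∷ʳ a) ≡ notIn a w ∧ distinct w
distinct-∷ʳ a []      = refl
distinct-∷ʳ a (b ∷ w) = begin
  notIn b (w ∷ʳ a) ∧ distinct (w ∷ʳ a)                     ≡⟨ cong₂ _∧_ (notIn-∷ʳ b a w) (distinct-∷ʳ a w) ⟩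
  (not ⌊ b ≟ a ⌋ ∧ notIn b w) ∧ (notIn a w ∧ distinct w)  ≡⟨ ∧.interchange (not ⌊ b ≟ a ⌋) (notIn b w) (notIn a w) (distinct w) ⟩
  (not ⌊ b ≟ a ⌋ ∧ notIn a w) ∧ (notIn b w ∧ distinct w)  ≡⟨ cong (λ e → (not e ∧ notIn a w) ∧ _) b≟a≡a≟b ⟩
  (not ⌊ a ≟ b ⌋ ∧ notIn a w) ∧ (notIn b w ∧ distinct w)  ∎
  where
  open ≡-Reasoning
  b≟a≡a≟b : ⌊ b ≟ a ⌋ ≡ ⌊ a ≟ b ⌋
  b≟a≡a≟b = ⌊⌋-⇔ (mk⇔ sym sym) (b ≟ a) (a ≟ b)

distinct-rotate^ : ∀ j (v : Vec (Fin n) (suc k)) → distinct (rotate^ j v) ≡ distinct v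
distinct-rotate^ zero    v       = refl
distinct-rotate^ (suc j) (a ∷ w) = trans (distinct-rotate^ j (w ∷ʳ a)) (distinct-∷ʳ a w)

notIn⇒≢lookup : ∀ a (w : Vec (Fin n) k) → notIn a w ≡ true → ∀ i → a ≢ lookup w i
notIn⇒≢lookup a (b ∷ w) h i with a ≟ b
notIn⇒≢lookup a (b ∷ w) () i      | yes _
notIn⇒≢lookup a (b ∷ w) h zero    | no a≢b = a≢b
notIn⇒≢lookup a (b ∷ w) h (suc i) | no _   = notIn⇒≢lookup a w h i

distinct⇒lookup-injective : ∀ (w : Vec (Fin n) k) → distinct w ≡ true → Injective _≡_ _≡_ (lookup w)
distinct⇒lookup-injective (a ∷ w) h {zero}  {zero}  _  = refl
distinct⇒lookup-injective (a ∷ w) h {zero}  {suc j} eq =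
  contradiction eq (notIn⇒≢lookup a w (∧-conicalˡ _ _ h) j)
distinct⇒lookup-injective (a ∷ w) h {suc i} {zero}  eq =
  contradiction (sym eq) (notIn⇒≢lookup a w (∧-conicalˡ _ _ h) i)
distinct⇒lookup-injective (a ∷ w) h {suc i} {suc j} eq =
  cong suc (distinct⇒lookup-injective w (∧-conicalʳ _ _ h) eq)

notIn-inject₁ : ∀ a (w : Vec (Fin m) k) → notIn (inject₁ a) (mapᵥ inject₁ w) ≡ notIn a w
notIn-inject₁ a []      = refl
notIn-inject₁ a (b ∷ w) = cong₂ (λ x y → not x ∧ y)
  (⌊⌋-⇔ (mk⇔ inject₁-injective (cong inject₁)) (inject₁ a ≟ inject₁ b) (a ≟ b)) (notIn-inject₁ a w)

distinct-inject₁ : ∀ (w : Vec (Fin m) k) → distinct (mapᵥ inject₁ w) ≡ distinct w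
distinct-inject₁ []      = refl
distinct-inject₁ (a ∷ w) = cong₂ _∧_ (notIn-inject₁ a w) (distinct-inject₁ w)

cdes-fromℕ∷ : ∀ (σ : Vec (Fin (suc m)) (suc k)) → notIn (fromℕ m) σ ≡ true →
  cdes (fromℕ m ∷ σ) ≡ suc (des σ)
cdes-fromℕ∷ {m} (b ∷ σ) top∉σ = begin
  isDescent (fromℕ m) b + des (b ∷ σ) + isDescent (last (b ∷ σ)) (fromℕ m)
    ≡⟨ cong₂ (λ x y → x + des (b ∷ σ) + y) (isDescent-fromℕˡ b b≢top) (isDescent-fromℕʳ (last (b ∷ σ))) ⟩
  suc (des (b ∷ σ)) + 0
    ≡⟨ +-identityʳ _ ⟩
  suc (des (b ∷ σ))
    ∎
  where
  open ≡-Reasoning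
  b≢top : b ≢ fromℕ m
  b≢top = ≢-sym (notIn⇒≢lookup (fromℕ m) (b ∷ σ) top∉σ zero)

∑-head-rotate^-opposite : ∀ (π : Vec (Fin (suc m)) (suc m)) → distinct π ≡ true → ∀ t →
  ∑[ j < suc m ] toN ⌊ head (rotate^ (toℕ (opposite j)) π) ≟ t ⌋ ≡ 1
∑-head-rotate^-opposite {m} π h t = begin
  ∑[ j < suc m ] toN ⌊ head (rotate^ (toℕ (opposite j)) π) ≟ t ⌋
    ≡⟨ ∑-reverse {suc m} (λ j → toN ⌊ head (rotate^ (toℕ j) π) ≟ t ⌋) ⟩
  ∑[ j < suc m ] toN ⌊ head (rotate^ (toℕ j) π) ≟ t ⌋
    ≡⟨ sum-cong-≗ {suc m} (λ j → cong (λ x → toN ⌊ x ≟ t ⌋) (head-rotate^ π j refl)) ⟩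
  ∑[ j < suc m ] toN ⌊ lookup π j ≟ t ⌋
    ≡⟨ injective⇒∑-fibre≡1 (distinct⇒lookup-injective π h) t ⟩
  1 ∎
  where open ≡-Reasoning

-- Sums over the symmetric group

sumSym : ∀ n → (Vec (Fin n) n → ℕ) → ℕ
sumSym n F = ∑[ π ∈ allWords n n ] (toN (distinct π) * F π)

countSym≡sumSym : ∀ n P → countSym n P ≡ sumSym n (toN ∘ P)
countSym≡sumSym n P =
  trans (length≡sumOver-filterᵇ P (Sym n)) (sumOver-filterᵇ distinct (toN ∘ P) (allWords n n))

sumSym-cong : ∀ {F G : Vec (Fin n) n → ℕ} → F ≗ G → sumSym n F ≡ sumSym n G
sumSym-cong {n} F≗G = sumOver-cong (allWords n n) (λ π → cong (toN (distinct π) *_) (F≗G π))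

sumSym-+ : ∀ (F G : Vec (Fin n) n → ℕ) → sumSym n (λ π → F π + G π) ≡ sumSym n F + sumSym n G
sumSym-+ {n} F G = trans (sumOver-cong (allWords n n) (λ π → *-distribˡ-+ (toN (distinct π)) (F π) (G π)))
                         (sumOver-+ (allWords n n) (λ π → toN (distinct π) * F π) (λ π → toN (distinct π) * G π))

-- The largest letter of a permutation π occupies exactly one position, so 1 = ∑ⱼ [head (rotate^ (opposite j) π) = n];
-- substituting π = rotate^ (1 + j) τ, which undoes rotate^ (opposite j), brings that letter to the front.
sumSym-orbits : ∀ m (F : Vec (Fin (suc m)) (suc m) → ℕ) →
  sumSym (suc m) F ≡ ∑[ σ ∈ allWords (suc m) m ] (toN (distinct (fromℕ m ∷ σ)) * orbitSum F (fromℕ m ∷ σ))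
sumSym-orbits m F = begin
  ∑[ π ∈ W ] (ι π * F π)
    ≡⟨ sumOver-cong W (λ π → indicator-absorbs (distinct π) (F π) (λ d → ∑-head-rotate^-opposite π d top)) ⟩
  ∑[ π ∈ W ] (∑[ j < suc m ] h j π * (ι π * F π))
    ≡⟨ sumOver-cong W (λ π → *-distribʳ-sum {suc m} (ι π * F π) (λ j → h j π)) ⟩
  ∑[ π ∈ W ] ∑[ j < suc m ] (h j π * (ι π * F π))
    ≡⟨ sumOver-∑-comm {n = suc m} W (λ π j → h j π * (ι π * F π)) ⟩
  ∑[ j < suc m ] ∑[ π ∈ W ] (h j π * (ι π * F π))
    ≡⟨ sum-cong-≗ {suc m} substitute-rotation ⟩
  ∑[ j < suc m ] ∑[ τ ∈ W ] (headTop τ * (ι τ * F (rotate^ (suc (toℕ j)) τ)))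
    ≡⟨ sumOver-∑-comm {n = suc m} W (λ τ j → headTop τ * (ι τ * F (rotate^ (suc (toℕ j)) τ))) ⟨
  ∑[ τ ∈ W ] ∑[ j < suc m ] (headTop τ * (ι τ * F (rotate^ (suc (toℕ j)) τ)))
    ≡⟨ sumOver-cong W factor ⟩
  ∑[ τ ∈ W ] (headTop τ * (ι τ * orbitSum F τ))
    ≡⟨ sumOver-allWords-∷ (suc m) m (λ τ → headTop τ * (ι τ * orbitSum F τ)) ⟩
  ∑[ σ ∈ allWords (suc m) m ] ∑[ a < suc m ] (toN ⌊ a ≟ top ⌋ * (ι (a ∷ σ) * orbitSum F (a ∷ σ)))
    ≡⟨ sumOver-cong (allWords (suc m) m) (λ σ → ∑-select top (λ a → ι (a ∷ σ) * orbitSum F (a ∷ σ))) ⟩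
  ∑[ σ ∈ allWords (suc m) m ] (ι (top ∷ σ) * orbitSum F (top ∷ σ))
    ∎
  where
  open ≡-Reasoning
  top = fromℕ m
  W = allWords (suc m) (suc m)
  ι headTop : Vec (Fin (suc m)) (suc m) → ℕ
  ι π = toN (distinct π)
  headTop τ = toN ⌊ head τ ≟ top ⌋
  h : Fin (suc m) → Vec (Fin (suc m)) (suc m) → ℕ
  h j π = headTop (rotate^ (toℕ (opposite j)) π)
  substitute-rotation : ∀ j →
    ∑[ π ∈ W ] (h j π * (ι π * F π)) ≡ ∑[ τ ∈ W ] (headTop τ * (ι τ * F (rotate^ (suc (toℕ j)) τ)))
  substitute-rotation j =
    trans (sym (sumOver-allWords-rotate^ (suc m) m (suc (toℕ j)) (λ π → h j π * (ι π * F π))))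
          (sumOver-cong W λ τ → cong₂ (λ x y → toN ⌊ x ≟ top ⌋ * (toN y * F (rotate^ (suc (toℕ j)) τ)))
                                      (head-rotate^-opposite τ j) (distinct-rotate^ (suc (toℕ j)) τ))
  factor : ∀ τ → ∑[ j < suc m ] (headTop τ * (ι τ * F (rotate^ (suc (toℕ j)) τ))) ≡ headTop τ * (ι τ * orbitSum F τ)
  factor τ = sym (trans (cong (headTop τ *_) (*-distribˡ-sum {suc m} (ι τ) (λ j → F (rotate^ (suc (toℕ j)) τ))))
                        (*-distribˡ-sum {suc m} (headTop τ) (λ j → ι τ * F (rotate^ (suc (toℕ j)) τ))))

orbitContribution-fromℕ∷ : ∀ d (F : Vec (Fin (suc m)) (suc (suc k)) → ℕ) c →
  (∀ τ → cdes τ ≡ suc d → orbitSum F τ ≡ c) → ∀ σ →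
  toN (distinct (fromℕ m ∷ σ)) * orbitSum (λ π → toN (cdes π ≡ᵇ suc d) * F π) (fromℕ m ∷ σ)
  ≡ toN (notIn (fromℕ m) σ) * (toN (distinct σ) * toN (des σ ≡ᵇ d) * c)
orbitContribution-fromℕ∷ {m} d F c orbit≡c σ with notIn (fromℕ m) σ in top∉σ
... | false = refl
... | true  = begin
  toN (distinct σ) * orbitSum (λ π → toN (cdes π ≡ᵇ suc d) * F π) (top ∷ σ)
    ≡⟨ cong (toN (distinct σ) *_) (orbitSum-cdes-* (λ x → toN (x ≡ᵇ suc d)) F (top ∷ σ)) ⟩
  toN (distinct σ) * (toN (cdes (top ∷ σ) ≡ᵇ suc d) * orbitSum F (top ∷ σ))
    ≡⟨ cong (toN (distinct σ) *_) (≡ᵇ-indicator-cong (cdes (top ∷ σ)) (suc d) (orbit≡c (top ∷ σ))) ⟩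
  toN (distinct σ) * (toN (cdes (top ∷ σ) ≡ᵇ suc d) * c)
    ≡⟨ cong (λ x → toN (distinct σ) * (toN (x ≡ᵇ suc d) * c)) (cdes-fromℕ∷ σ top∉σ) ⟩
  toN (distinct σ) * (toN (des σ ≡ᵇ d) * c)
    ≡⟨ *-assoc (toN (distinct σ)) _ c ⟨
  toN (distinct σ) * toN (des σ ≡ᵇ d) * c
    ≡⟨ *-identityˡ _ ⟨
  1 * (toN (distinct σ) * toN (des σ ≡ᵇ d) * c)
    ∎
  where
  open ≡-Reasoning
  top = fromℕ m

sumSym-by-orbits : ∀ k d (F : Vec (Fin (suc (suc k))) (suc (suc k)) → ℕ) c →
  (∀ τ → cdes τ ≡ suc d → orbitSum F τ ≡ c) →
  sumSym (suc (suc k)) (λ π → toN (cdes π ≡ᵇ suc d) * F π) ≡ A (suc k) (suc d) * c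
sumSym-by-orbits k d F c orbit≡c = begin
  sumSym (suc (suc k)) (λ π → toN (cdes π ≡ᵇ suc d) * F π)
    ≡⟨ sumSym-orbits (suc k) _ ⟩
  ∑[ σ ∈ allWords (suc (suc k)) (suc k) ]
    (toN (distinct (top ∷ σ)) * orbitSum (λ π → toN (cdes π ≡ᵇ suc d) * F π) (top ∷ σ))
    ≡⟨ sumOver-cong (allWords (suc (suc k)) (suc k)) (orbitContribution-fromℕ∷ d F c orbit≡c) ⟩
  ∑[ σ ∈ allWords (suc (suc k)) (suc k) ] (toN (notIn top σ) * (toN (distinct σ) * toN (des σ ≡ᵇ d) * c))
    ≡⟨ sumOver-allWords-avoiding-fromℕ (suc k) (suc k) _ ⟩
  ∑[ σ ∈ allWords (suc k) (suc k) ] (toN (distinct (mapᵥ inject₁ σ)) * toN (des (mapᵥ inject₁ σ) ≡ᵇ d) * c)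
    ≡⟨ sumOver-cong (allWords (suc k) (suc k)) (λ σ →
         cong₂ (λ x y → toN x * toN (y ≡ᵇ d) * c) (distinct-inject₁ σ) (des-inject₁ σ)) ⟩
  ∑[ σ ∈ allWords (suc k) (suc k) ] (toN (distinct σ) * toN (des σ ≡ᵇ d) * c)
    ≡⟨ sumOver-*ʳ (allWords (suc k) (suc k)) (λ σ → toN (distinct σ) * toN (des σ ≡ᵇ d)) c ⟩
  sumSym (suc k) (λ σ → toN (des σ ≡ᵇ d)) * c
    ≡⟨ cong (_* c) (countSym≡sumSym (suc k) (λ σ → des σ ≡ᵇ d)) ⟨
  A (suc k) (suc d) * c
    ∎
  where
  open ≡-Reasoning
  top = fromℕ (suc k)

indicator-endDescent : ∀ (π : Vec (Fin n) (suc k)) d →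
  toN ((cdes π ≡ᵇ suc d) ∧ (des π ≡ᵇ d)) ≡ toN (cdes π ≡ᵇ suc d) * endDescent π
indicator-endDescent (a ∷ w) d = split (des (a ∷ w)) (toℕ a <ᵇ toℕ (last (a ∷ w)))
  where
  split : ∀ x β → toN ((x + toN β ≡ᵇ suc d) ∧ (x ≡ᵇ d)) ≡ toN (x + toN β ≡ᵇ suc d) * toN β
  split x true  rewrite +-comm x 1 = toN-∧-idem (x ≡ᵇ d)
  split x false rewrite +-identityʳ x | ≡ᵇ-suc-exclusive x d = sym (*-zeroʳ (toN (x ≡ᵇ suc d)))

indicators-partition-cdes : ∀ (π : Vec (Fin n) (suc k)) d →
  toN ((cdes π ≡ᵇ suc d) ∧ (des π ≡ᵇ d)) + toN ((cdes π ≡ᵇ suc d) ∧ (des π ≡ᵇ suc d))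
  ≡ toN (cdes π ≡ᵇ suc d) * 1
indicators-partition-cdes (a ∷ w) d = split (des (a ∷ w)) (toℕ a <ᵇ toℕ (last (a ∷ w)))
  where
  split : ∀ x β → toN ((x + toN β ≡ᵇ suc d) ∧ (x ≡ᵇ d)) + toN ((x + toN β ≡ᵇ suc d) ∧ (x ≡ᵇ suc d))
                  ≡ toN (x + toN β ≡ᵇ suc d) * 1
  split x true  rewrite +-comm x 1 | ∧-comm (x ≡ᵇ d) (x ≡ᵇ suc d) | ≡ᵇ-suc-exclusive x d =
    trans (+-identityʳ _) (toN-∧-idem (x ≡ᵇ d))
  split x false rewrite +-identityʳ x | ≡ᵇ-suc-exclusive x d = toN-∧-idem (x ≡ᵇ suc d)

count-with-endDescent : ∀ k d →
  countSym (suc (suc k)) (λ π → (cdes π ≡ᵇ suc d) ∧ (des π ≡ᵇ d)) ≡ A (suc k) (suc d) * suc d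
count-with-endDescent k d = begin
  countSym (suc (suc k)) (λ π → (cdes π ≡ᵇ suc d) ∧ (des π ≡ᵇ d))
    ≡⟨ countSym≡sumSym (suc (suc k)) (λ π → (cdes π ≡ᵇ suc d) ∧ (des π ≡ᵇ d)) ⟩
  sumSym (suc (suc k)) (λ π → toN ((cdes π ≡ᵇ suc d) ∧ (des π ≡ᵇ d)))
    ≡⟨ sumSym-cong {suc (suc k)} (λ π → indicator-endDescent π d) ⟩
  sumSym (suc (suc k)) (λ π → toN (cdes π ≡ᵇ suc d) * endDescent π)
    ≡⟨ sumSym-by-orbits k d endDescent (suc d) (λ τ cdτ≡d → trans (orbitSum-endDescent τ) cdτ≡d) ⟩
  A (suc k) (suc d) * suc d
    ∎
  where open ≡-Reasoning

count-with+without-endDescent : ∀ k d →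
  countSym (suc (suc k)) (λ π → (cdes π ≡ᵇ suc d) ∧ (des π ≡ᵇ d))
    + countSym (suc (suc k)) (λ π → (cdes π ≡ᵇ suc d) ∧ (des π ≡ᵇ suc d))
  ≡ A (suc k) (suc d) * suc (suc k)
count-with+without-endDescent k d = begin
  countSym (suc (suc k)) P₁ + countSym (suc (suc k)) P₂
    ≡⟨ cong₂ _+_ (countSym≡sumSym _ P₁) (countSym≡sumSym _ P₂) ⟩
  sumSym (suc (suc k)) (toN ∘ P₁) + sumSym (suc (suc k)) (toN ∘ P₂)
    ≡⟨ sumSym-+ (toN ∘ P₁) (toN ∘ P₂) ⟨
  sumSym (suc (suc k)) (λ π → toN (P₁ π) + toN (P₂ π))
    ≡⟨ sumSym-cong {suc (suc k)} (λ π → indicators-partition-cdes π d) ⟩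
  sumSym (suc (suc k)) (λ π → toN (cdes π ≡ᵇ suc d) * 1)
    ≡⟨ sumSym-by-orbits k d (λ _ → 1) (suc (suc k)) (λ τ _ → trans (∑-const (suc (suc k)) 1) (*-identityʳ _)) ⟩
  A (suc k) (suc d) * suc (suc k)
    ∎
  where
  open ≡-Reasoning
  P₁ P₂ : Vec (Fin (suc (suc k))) (suc (suc k)) → Bool
  P₁ π = (cdes π ≡ᵇ suc d) ∧ (des π ≡ᵇ d)
  P₂ π = (cdes π ≡ᵇ suc d) ∧ (des π ≡ᵇ suc d)

count-without-endDescent : ∀ k d →
  countSym (suc (suc k)) (λ π → (cdes π ≡ᵇ suc d) ∧ (des π ≡ᵇ suc d)) ≡ (suc (suc k) ∸ suc d) * A (suc k) (suc d)
count-without-endDescent k d = begin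
  c₂                            ≡⟨ m+n∸m≡n c₁ c₂ ⟨
  c₁ + c₂ ∸ c₁                  ≡⟨ cong₂ _∸_ (count-with+without-endDescent k d) (count-with-endDescent k d) ⟩
  a * suc (suc k) ∸ a * suc d   ≡⟨ cong₂ _∸_ (*-comm a _) (*-comm a _) ⟩
  suc (suc k) * a ∸ suc d * a   ≡⟨ *-distribʳ-∸ a (suc (suc k)) (suc d) ⟨
  (suc (suc k) ∸ suc d) * a     ∎
  where
  open ≡-Reasoning
  a  = A (suc k) (suc d)
  c₁ = countSym (suc (suc k)) (λ π → (cdes π ≡ᵇ suc d) ∧ (des π ≡ᵇ d))
  c₂ = countSym (suc (suc k)) (λ π → (cdes π ≡ᵇ suc d) ∧ (des π ≡ᵇ suc d))

mainTheorem2 : (n d : ℕ) → 1 < n → 1 ≤ d →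
    (countSym n (λ π → (cdes π ≡ᵇ d) ∧ (des π ≡ᵇ (d ∸ 1))) ≡ d * A (n ∸ 1) d)
    × (countSym n (λ π → (cdes π ≡ᵇ d) ∧ (des π ≡ᵇ d)) ≡ (n ∸ d) * A (n ∸ 1) d)
mainTheorem2 (suc zero)    _       (s≤s ()) _
mainTheorem2 (suc (suc k)) (suc d) _        _ =
  trans (count-with-endDescent k d) (*-comm _ (suc d)) , count-without-endDescent k d
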